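{- Let $t \geq 1$ and $k \geq t+1$ be integers, and let $n$ be sufficiently large with respect to $k$ and $t$. Let \[\mathcal{A}_t = \left\{ A \in \binom{[n]}{k} : |A \cap \{1,2,\ldots,t+2\}| \geq t+1\right\}.\] Then \[|\mathcal{I}(\mathcal{A}_t)| = \binom{t+2}{t} \sum_{j=0}^{k-t-1} \binom{n-t-2}{j} + \binom{t+2}{t+1} \sum_{j=0}^{k-t-2} \binom{n-t-2}{j} + \sum_{j=0}^{k-t-3} \binom{n-t-2}{j},\] where an empty sum (upper index negative) equals $0$.
   Context: $[n]=\{1,2,\ldots,n\}$ and $\binom{[n]}{k}$ denotes the family of all $k$-element subsets of $[n]$. For a family $\mathcal{F}$ of sets, $\mathcal{I}(\mathcal{F}) = \{F \cap G : F, G \in \mathcal{F},\ F \neq G\}$ is the collection of all distinct pairwise intersections of distinct members of $\mathcal{F}$. -}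

module Defs where

open import Data.Nat using (ℕ; _+_; _∸_; _≤_; _<ᵇ_)
open import Data.Nat.Combinatorics using (_C_)
open import Data.List using (List; map; upTo)
open import Data.Nat.ListAction using (sum)
open import Data.Fin using (Fin; toℕ)
open import Data.Fin.Subset using (Subset; _∩_; ∣_∣)
open import Data.Vec using (tabulate)
open import Data.Product using (Σ; _×_; ∃)
open import Relation.Binary.PropositionalEquality using (_≡_; _≢_)

sumBelow : ℕ → (ℕ → ℕ) → ℕ
sumBelow m f = sum (map f (upTo m))

-- Elements of [n] are represented by Fin n, element i ∈ Fin n standing for i+1.
-- The initial segment {1,...,m} as a subset of [n].
initSeg : (n m : ℕ) → Subset n
initSeg n m = tabulate (λ i → toℕ i <ᵇ m)

InA : (n k t : ℕ) → Subset n → Set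
InA n k t A = (∣ A ∣ ≡ k) × (t + 1 ≤ ∣ A ∩ initSeg n (t + 2) ∣)

InI : (n k t : ℕ) → Subset n → Set
InI n k t S = Σ (Subset n) λ F → Σ (Subset n) λ G →
  InA n k t F × InA n k t G × F ≢ G × (F ∩ G ≡ S)

rhs : (n k t : ℕ) → ℕ
rhs n k t =
    ((t + 2) C t) * sumBelow (k ∸ t) (λ j → (n ∸ (t + 2)) C j)
  + ((t + 2) C (t + 1)) * sumBelow (k ∸ (t + 1)) (λ j → (n ∸ (t + 2)) C j)
  + sumBelow (k ∸ (t + 2)) (λ j → (n ∸ (t + 2)) C j)
  where open import Data.Nat using (_*_)

-- Write [n] = P ∪ M with P = [t + 2] and ∣M∣ = m. A set S lies in I(A_t) iff ∣S ∩ P∣ ≥ t and ∣S∣ < k.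
-- Necessity: F ∩ P and G ∩ P each miss at most one of the t + 2 points of P, so they share at least t,
-- and distinct k-sets meet in fewer than k points. Sufficiency (for m ≥ 3k): pad S inside P by one
-- private point for each of F and G when ∣S ∩ P∣ = t, then inside M by equally many private points
-- to reach size k; the pads are disjoint, so F ∩ G = S. Counting by a = ∣S ∩ P∣ ∈ {t, t + 1, t + 2}
-- gives C(t + 2, a) traces on P times Σ_{j < k - a} C(m, j) traces on M.
module Submission where

open import Defs
open import Data.Nat using (ℕ; zero; suc; _+_; _*_; _∸_; _≤_; _<_; z≤n; s≤s)
open import Data.Nat.Properties
open import Data.Nat.Tactic.RingSolver using (solve-∀)
open import Data.Nat.Combinatorics using (_C_; nCn≡1; nCk+nC[k+1]≡[n+1]C[k+1])
open import Data.Nat.ListAction using (sum)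
open import Data.Nat.ListAction.Properties using (sum-++)
open import Data.Bool using (_∧_)
open import Function using (_∘_; case_of_)
open import Data.Vec using ([]; _∷_; _++_; splitAt)
open import Data.Vec.Properties using (zipWith-++; ∷-injectiveʳ; ++-injective)
open import Data.Fin.Subset using (Subset; inside; outside; _∩_; _∪_; ∣_∣; ⊤; ⊥)
open import Data.Fin.Subset.Properties
  using (∣p∣≤n; ∣p∩q∣≤∣p∣; ∩-comm; ∩-idem; ∩-identityʳ; ∩-zeroʳ; ∣⊥∣≡0)
open import Data.List using (List; []; _∷_; [_]; map; length; upTo; cartesianProductWith)
  renaming (_++_ to _++ₗ_)
open import Data.List.Properties using (length-++; length-map; map-++; upTo-∷ʳ)
open import Data.List.Membership.Propositional using (_∈_)
open import Data.List.Membership.Propositional.Properties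
  using (∈-++⁺ˡ; ∈-++⁺ʳ; ∈-++⁻; ∈-map⁺; ∈-map⁻; ∈-cartesianProductWith⁺; ∈-cartesianProductWith⁻)
open import Data.List.Relation.Unary.Any using (here)
open import Data.List.Relation.Unary.All using ([])
open import Data.List.Relation.Unary.Unique.Propositional using (Unique; []; _∷_)
open import Data.List.Relation.Unary.Unique.Propositional.Properties
  using (++⁺; map⁺; cartesianProductWith⁺)
open import Data.List.Relation.Binary.Disjoint.Propositional using (Disjoint)
open import Data.Product using (Σ; _×_; _,_; proj₁)
open import Data.Sum using (_⊎_; inj₁; inj₂)
import Data.Sum as Sum
open import Function.Bundles using (_⇔_; mk⇔)
open import Relation.Nullary using (contradiction)
open import Relation.Binary.PropositionalEquality hiding ([_])

private
  variable
    a b k m n : ℕ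

∣p++q∣≡∣p∣+∣q∣ : (p : Subset a) (q : Subset b) → ∣ p ++ q ∣ ≡ ∣ p ∣ + ∣ q ∣
∣p++q∣≡∣p∣+∣q∣ []            q = refl
∣p++q∣≡∣p∣+∣q∣ (inside ∷ p)  q = cong suc (∣p++q∣≡∣p∣+∣q∣ p q)
∣p++q∣≡∣p∣+∣q∣ (outside ∷ p) q = ∣p++q∣≡∣p∣+∣q∣ p q

∣p∣+∣q∣≡∣p∪q∣+∣p∩q∣ : (p q : Subset n) → ∣ p ∣ + ∣ q ∣ ≡ ∣ p ∪ q ∣ + ∣ p ∩ q ∣
∣p∣+∣q∣≡∣p∪q∣+∣p∩q∣ [] [] = refl
∣p∣+∣q∣≡∣p∪q∣+∣p∩q∣ (inside ∷ p) (inside ∷ q) = cong suc (begin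
  ∣ p ∣ + suc ∣ q ∣             ≡⟨ +-suc ∣ p ∣ ∣ q ∣ ⟩
  suc (∣ p ∣ + ∣ q ∣)           ≡⟨ cong suc (∣p∣+∣q∣≡∣p∪q∣+∣p∩q∣ p q) ⟩
  suc (∣ p ∪ q ∣ + ∣ p ∩ q ∣)   ≡⟨ +-suc ∣ p ∪ q ∣ ∣ p ∩ q ∣ ⟨
  ∣ p ∪ q ∣ + suc ∣ p ∩ q ∣     ∎)
  where open ≡-Reasoning
∣p∣+∣q∣≡∣p∪q∣+∣p∩q∣ (inside ∷ p) (outside ∷ q) = cong suc (∣p∣+∣q∣≡∣p∪q∣+∣p∩q∣ p q)
∣p∣+∣q∣≡∣p∪q∣+∣p∩q∣ (outside ∷ p) (inside ∷ q) =
  trans (+-suc ∣ p ∣ ∣ q ∣) (cong suc (∣p∣+∣q∣≡∣p∪q∣+∣p∩q∣ p q))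
∣p∣+∣q∣≡∣p∪q∣+∣p∩q∣ (outside ∷ p) (outside ∷ q) = ∣p∣+∣q∣≡∣p∪q∣+∣p∩q∣ p q

∣p∣+∣q∣≤n+∣p∩q∣ : (p q : Subset n) → ∣ p ∣ + ∣ q ∣ ≤ n + ∣ p ∩ q ∣
∣p∣+∣q∣≤n+∣p∩q∣ p q =
  ≤-trans (≤-reflexive (∣p∣+∣q∣≡∣p∪q∣+∣p∩q∣ p q)) (+-monoˡ-≤ ∣ p ∩ q ∣ (∣p∣≤n (p ∪ q)))

∣p∩q∣≡∣p∣⇒p∩q≡p : (p q : Subset n) → ∣ p ∩ q ∣ ≡ ∣ p ∣ → p ∩ q ≡ p
∣p∩q∣≡∣p∣⇒p∩q≡p [] [] _ = refl
∣p∩q∣≡∣p∣⇒p∩q≡p (inside ∷ p) (inside ∷ q) e = cong (inside ∷_) (∣p∩q∣≡∣p∣⇒p∩q≡p p q (suc-injective e))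
∣p∩q∣≡∣p∣⇒p∩q≡p (inside ∷ p) (outside ∷ q) e = contradiction e (<⇒≢ (s≤s (∣p∩q∣≤∣p∣ p q)))
∣p∩q∣≡∣p∣⇒p∩q≡p (outside ∷ p) (_ ∷ q) e = cong (outside ∷_) (∣p∩q∣≡∣p∣⇒p∩q≡p p q e)

∣p∩q∣<k : (p q : Subset n) → ∣ p ∣ ≡ k → ∣ q ∣ ≡ k → p ≢ q → ∣ p ∩ q ∣ < k
∣p∩q∣<k {k = k} p q ∣p∣≡k ∣q∣≡k p≢q = ≤∧≢⇒< (subst (∣ p ∩ q ∣ ≤_) ∣p∣≡k (∣p∩q∣≤∣p∣ p q)) ∣p∩q∣≢k
  where
  ∣p∩q∣≢k : ∣ p ∩ q ∣ ≢ k
  ∣p∩q∣≢k e = p≢q (begin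
    p      ≡⟨ ∣p∩q∣≡∣p∣⇒p∩q≡p p q (trans e (sym ∣p∣≡k)) ⟨
    p ∩ q  ≡⟨ ∩-comm p q ⟩
    q ∩ p  ≡⟨ ∣p∩q∣≡∣p∣⇒p∩q≡p q p (trans (cong ∣_∣ (∩-comm q p)) (trans e (sym ∣q∣≡k))) ⟩
    q      ∎)
    where open ≡-Reasoning

extendApart : (x : Subset n) (a b : ℕ) → a + b + ∣ x ∣ ≤ n →
  Σ (Subset n) λ F → Σ (Subset n) λ G → F ∩ G ≡ x × ∣ F ∣ ≡ ∣ x ∣ + a × ∣ G ∣ ≡ ∣ x ∣ + b
extendApart x zero zero _ = x , x , ∩-idem x , sym (+-identityʳ _) , sym (+-identityʳ _)
extendApart [] (suc a) b ()
extendApart [] zero (suc b) ()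
extendApart {suc n} (inside ∷ x) a b h
  with F , G , F∩G≡x , ∣F∣ , ∣G∣ ← extendApart x a b (≤-pred (subst (_≤ suc n) (+-suc (a + b) ∣ x ∣) h))
  = inside ∷ F , inside ∷ G , cong (inside ∷_) F∩G≡x , cong suc ∣F∣ , cong suc ∣G∣
extendApart (outside ∷ x) (suc a) b h
  with F , G , F∩G≡x , ∣F∣ , ∣G∣ ← extendApart x a b (≤-pred h)
  = inside ∷ F , outside ∷ G , cong (outside ∷_) F∩G≡x , trans (cong suc ∣F∣) (sym (+-suc ∣ x ∣ a)) , ∣G∣
extendApart (outside ∷ x) zero (suc b) h
  with F , G , F∩G≡x , ∣F∣ , ∣G∣ ← extendApart x zero b (≤-pred h)
  = outside ∷ F , inside ∷ G , cong (outside ∷_) F∩G≡x , ∣F∣ , trans (cong suc ∣G∣) (sym (+-suc ∣ x ∣ b))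

initSeg≡⊤++⊥ : ∀ a m → initSeg (a + m) a ≡ ⊤ {a} ++ ⊥ {m}
initSeg≡⊤++⊥ zero    m = initSeg-zero m
  where
  initSeg-zero : ∀ m → initSeg m 0 ≡ ⊥
  initSeg-zero zero    = refl
  initSeg-zero (suc m) = cong (outside ∷_) (initSeg-zero m)
initSeg≡⊤++⊥ (suc a) m = cong (inside ∷_) (initSeg≡⊤++⊥ a m)

∣p++q∩initSeg∣≡∣p∣ : (p : Subset a) (q : Subset m) → ∣ (p ++ q) ∩ initSeg (a + m) a ∣ ≡ ∣ p ∣
∣p++q∩initSeg∣≡∣p∣ {a} {m} p q = begin
  ∣ (p ++ q) ∩ initSeg (a + m) a ∣  ≡⟨ cong (λ s → ∣ (p ++ q) ∩ s ∣) (initSeg≡⊤++⊥ a m) ⟩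
  ∣ (p ++ q) ∩ (⊤ {a} ++ ⊥) ∣       ≡⟨ cong ∣_∣ (zipWith-++ _∧_ p q ⊤ ⊥) ⟩
  ∣ (p ∩ ⊤) ++ (q ∩ ⊥) ∣             ≡⟨ cong₂ (λ s r → ∣ s ++ r ∣) (∩-identityʳ p) (∩-zeroʳ q) ⟩
  ∣ p ++ ⊥ {m} ∣                      ≡⟨ ∣p++q∣≡∣p∣+∣q∣ p ⊥ ⟩
  ∣ p ∣ + ∣ ⊥ {m} ∣                   ≡⟨ cong (∣ p ∣ +_) (∣⊥∣≡0 m) ⟩
  ∣ p ∣ + 0                           ≡⟨ +-identityʳ ∣ p ∣ ⟩
  ∣ p ∣                               ∎
  where open ≡-Reasoning

ofWeight : (m j : ℕ) → List (Subset m)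
ofWeight zero    zero    = [ [] ]
ofWeight zero    (suc j) = []
ofWeight (suc m) zero    = map (outside ∷_) (ofWeight m zero)
ofWeight (suc m) (suc j) = map (inside ∷_) (ofWeight m j) ++ₗ map (outside ∷_) (ofWeight m (suc j))

length-ofWeight : ∀ m j → length (ofWeight m j) ≡ m C j
length-ofWeight zero    zero    = refl
length-ofWeight zero    (suc j) = refl
length-ofWeight (suc m) zero    = trans (length-map _ (ofWeight m zero)) (length-ofWeight m zero)
length-ofWeight (suc m) (suc j) = begin
  length (map (inside ∷_) (ofWeight m j) ++ₗ map (outside ∷_) (ofWeight m (suc j)))
    ≡⟨ length-++ (map (inside ∷_) (ofWeight m j)) ⟩
  length (map (inside ∷_) (ofWeight m j)) + length (map (outside ∷_) (ofWeight m (suc j)))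
    ≡⟨ cong₂ _+_ (length-map _ (ofWeight m j)) (length-map _ (ofWeight m (suc j))) ⟩
  length (ofWeight m j) + length (ofWeight m (suc j))
    ≡⟨ cong₂ _+_ (length-ofWeight m j) (length-ofWeight m (suc j)) ⟩
  m C j + m C suc j
    ≡⟨ nCk+nC[k+1]≡[n+1]C[k+1] m j ⟩
  suc m C suc j
    ∎
  where open ≡-Reasoning

∈-ofWeight⁺ : (x : Subset m) → x ∈ ofWeight m ∣ x ∣
∈-ofWeight⁺ [] = here refl
∈-ofWeight⁺ (inside ∷ x) = ∈-++⁺ˡ (∈-map⁺ (inside ∷_) (∈-ofWeight⁺ x))
∈-ofWeight⁺ {suc m} (outside ∷ x) with ∣ x ∣ | ∈-ofWeight⁺ x
... | zero  | x∈ = ∈-map⁺ (outside ∷_) x∈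
... | suc j | x∈ = ∈-++⁺ʳ (map (inside ∷_) (ofWeight m j)) (∈-map⁺ (outside ∷_) x∈)

∈-ofWeight⁻ : ∀ m j {x : Subset m} → x ∈ ofWeight m j → ∣ x ∣ ≡ j
∈-ofWeight⁻ zero zero {[]} _ = refl
∈-ofWeight⁻ (suc m) zero x∈
  with _ , y∈ , refl ← ∈-map⁻ (outside ∷_) x∈ = ∈-ofWeight⁻ m zero y∈
∈-ofWeight⁻ (suc m) (suc j) x∈ with ∈-++⁻ (map (inside ∷_) (ofWeight m j)) x∈
... | inj₁ x∈ˡ with _ , y∈ , refl ← ∈-map⁻ (inside ∷_) x∈ˡ = cong suc (∈-ofWeight⁻ m j y∈)
... | inj₂ x∈ʳ with _ , y∈ , refl ← ∈-map⁻ (outside ∷_) x∈ʳ = ∈-ofWeight⁻ m (suc j) y∈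

ofWeight-unique : ∀ m j → Unique (ofWeight m j)
ofWeight-unique zero    zero    = [] ∷ []
ofWeight-unique zero    (suc j) = []
ofWeight-unique (suc m) zero    = map⁺ ∷-injectiveʳ (ofWeight-unique m zero)
ofWeight-unique (suc m) (suc j) =
  ++⁺ (map⁺ ∷-injectiveʳ (ofWeight-unique m j)) (map⁺ ∷-injectiveʳ (ofWeight-unique m (suc j))) disjoint
  where
  disjoint : Disjoint (map (inside ∷_) (ofWeight m j)) (map (outside ∷_) (ofWeight m (suc j)))
  disjoint (x∈ˡ , x∈ʳ) with _ , _ , refl ← ∈-map⁻ (inside ∷_) x∈ˡ | _ , _ , () ← ∈-map⁻ (outside ∷_) x∈ʳ

sumBelow-suc : ∀ b (f : ℕ → ℕ) → sumBelow (suc b) f ≡ sumBelow b f + f b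
sumBelow-suc b f = begin
  sum (map f (upTo (suc b)))          ≡⟨ cong (sum ∘ map f) (upTo-∷ʳ b) ⟨
  sum (map f (upTo b ++ₗ [ b ]))      ≡⟨ cong sum (map-++ f (upTo b) [ b ]) ⟩
  sum (map f (upTo b) ++ₗ [ f b ])    ≡⟨ sum-++ (map f (upTo b)) [ f b ] ⟩
  sumBelow b f + (f b + 0)            ≡⟨ cong (sumBelow b f +_) (+-identityʳ (f b)) ⟩
  sumBelow b f + f b                  ∎
  where open ≡-Reasoning

ofWeightBelow : (m b : ℕ) → List (Subset m)
ofWeightBelow m zero    = []
ofWeightBelow m (suc b) = ofWeightBelow m b ++ₗ ofWeight m b

length-ofWeightBelow : ∀ m b → length (ofWeightBelow m b) ≡ sumBelow b (m C_)
length-ofWeightBelow m zero    = refl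
length-ofWeightBelow m (suc b) = begin
  length (ofWeightBelow m b ++ₗ ofWeight m b)
    ≡⟨ length-++ (ofWeightBelow m b) ⟩
  length (ofWeightBelow m b) + length (ofWeight m b)
    ≡⟨ cong₂ _+_ (length-ofWeightBelow m b) (length-ofWeight m b) ⟩
  sumBelow b (m C_) + m C b
    ≡⟨ sumBelow-suc b (m C_) ⟨
  sumBelow (suc b) (m C_)
    ∎
  where open ≡-Reasoning

∈-ofWeightBelow⁺ : ∀ b {x : Subset m} → ∣ x ∣ < b → x ∈ ofWeightBelow m b
∈-ofWeightBelow⁺ {m} (suc b) {x} ∣x∣<1+b with m<1+n⇒m<n∨m≡n ∣x∣<1+b
... | inj₁ ∣x∣<b = ∈-++⁺ˡ (∈-ofWeightBelow⁺ b ∣x∣<b)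
... | inj₂ refl  = ∈-++⁺ʳ (ofWeightBelow m b) (∈-ofWeight⁺ x)

∈-ofWeightBelow⁻ : ∀ b {x : Subset m} → x ∈ ofWeightBelow m b → ∣ x ∣ < b
∈-ofWeightBelow⁻ {m} (suc b) x∈ with ∈-++⁻ (ofWeightBelow m b) x∈
... | inj₁ x∈ˡ = m<n⇒m<1+n (∈-ofWeightBelow⁻ b x∈ˡ)
... | inj₂ x∈ʳ = ≤-reflexive (cong suc (∈-ofWeight⁻ m b x∈ʳ))

ofWeightBelow-unique : ∀ m b → Unique (ofWeightBelow m b)
ofWeightBelow-unique m zero    = []
ofWeightBelow-unique m (suc b) = ++⁺ (ofWeightBelow-unique m b) (ofWeight-unique m b) disjoint
  where
  disjoint : Disjoint (ofWeightBelow m b) (ofWeight m b)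
  disjoint (x∈ˡ , x∈ʳ) = <-irrefl (∈-ofWeight⁻ m b x∈ʳ) (∈-ofWeightBelow⁻ b x∈ˡ)

length-cartesianProductWith : {A B C : Set} (f : A → B → C) (xs : List A) (ys : List B) →
  length (cartesianProductWith f xs ys) ≡ length xs * length ys
length-cartesianProductWith f []       ys = refl
length-cartesianProductWith f (x ∷ xs) ys = begin
  length (map (f x) ys ++ₗ cartesianProductWith f xs ys)
    ≡⟨ length-++ (map (f x) ys) ⟩
  length (map (f x) ys) + length (cartesianProductWith f xs ys)
    ≡⟨ cong₂ _+_ (length-map (f x) ys) (length-cartesianProductWith f xs ys) ⟩
  length ys + length xs * length ys
    ∎
  where open ≡-Reasoning

+<⇒<∸ : ∀ a {b k} → a + b < k → b < k ∸ a
+<⇒<∸ zero                  a+b<k       = a+b<k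
+<⇒<∸ (suc a) {k = suc k} (s≤s a+b<k) = +<⇒<∸ a a+b<k

<∸⇒+< : ∀ a {b k} → b < k ∸ a → a + b < k
<∸⇒+< zero                  b<k∸a = b<k∸a
<∸⇒+< (suc a) {k = suc k} b<k∸a = s≤s (<∸⇒+< a b<k∸a)

stratum : (p m k a : ℕ) → List (Subset (p + m))
stratum p m k a = cartesianProductWith _++_ (ofWeight p a) (ofWeightBelow m (k ∸ a))

length-stratum : ∀ p m k a → length (stratum p m k a) ≡ (p C a) * sumBelow (k ∸ a) (m C_)
length-stratum p m k a = begin
  length (stratum p m k a)
    ≡⟨ length-cartesianProductWith _++_ (ofWeight p a) (ofWeightBelow m (k ∸ a)) ⟩
  length (ofWeight p a) * length (ofWeightBelow m (k ∸ a))
    ≡⟨ cong₂ _*_ (length-ofWeight p a) (length-ofWeightBelow m (k ∸ a)) ⟩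
  (p C a) * sumBelow (k ∸ a) (m C_)
    ∎
  where open ≡-Reasoning

stratum-unique : ∀ p m k a → Unique (stratum p m k a)
stratum-unique p m k a =
  cartesianProductWith⁺ _++_ (λ {u} {u'} → ++-injective u u')
    (ofWeight-unique p a) (ofWeightBelow-unique m (k ∸ a))

∈-stratum⁺ : ∀ {p m k a} (u : Subset p) (v : Subset m) →
  ∣ u ∣ ≡ a → ∣ u ∣ + ∣ v ∣ < k → u ++ v ∈ stratum p m k a
∈-stratum⁺ u v refl ∣uv∣<k =
  ∈-cartesianProductWith⁺ _++_ (∈-ofWeight⁺ u) (∈-ofWeightBelow⁺ _ (+<⇒<∸ ∣ u ∣ ∣uv∣<k))

∈-stratum⁻ : ∀ {p m k a} (u : Subset p) (v : Subset m) →
  u ++ v ∈ stratum p m k a → ∣ u ∣ ≡ a × ∣ u ∣ + ∣ v ∣ < k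
∈-stratum⁻ {p} {m} {k} {a} u v uv∈
  with u' , v' , u'∈ , v'∈ , uv≡u'v'
         ← ∈-cartesianProductWith⁻ _++_ (ofWeight p a) (ofWeightBelow m (k ∸ a)) uv∈
  with refl , refl ← ++-injective u u' uv≡u'v'
  with refl ← ∈-ofWeight⁻ p a u'∈
  = refl , <∸⇒+< ∣ u ∣ (∈-ofWeightBelow⁻ (k ∸ a) v'∈)

stratum-disjoint : ∀ p m k {a a'} → a ≢ a' → Disjoint (stratum p m k a) (stratum p m k a')
stratum-disjoint p m k {a} a≢a' (S∈ , S∈')
  with u , v , _ , _ , refl ← ∈-cartesianProductWith⁻ _++_ (ofWeight p a) (ofWeightBelow m (k ∸ a)) S∈
  = a≢a' (trans (sym (proj₁ (∈-stratum⁻ u v S∈))) (proj₁ (∈-stratum⁻ u v S∈')))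

t≤x≤t+2⇒x≡t∨t+1∨t+2 : ∀ t {x} → t ≤ x → x ≤ t + 2 → x ≡ t ⊎ x ≡ t + 1 ⊎ x ≡ t + 2
t≤x≤t+2⇒x≡t∨t+1∨t+2 zero    {zero}                z≤n _                   = inj₁ refl
t≤x≤t+2⇒x≡t∨t+1∨t+2 zero    {suc zero}            z≤n _                   = inj₂ (inj₁ refl)
t≤x≤t+2⇒x≡t∨t+1∨t+2 zero    {suc (suc zero)}      z≤n _                   = inj₂ (inj₂ refl)
t≤x≤t+2⇒x≡t∨t+1∨t+2 zero    {suc (suc (suc _))}   z≤n (s≤s (s≤s ()))
t≤x≤t+2⇒x≡t∨t+1∨t+2 (suc t) (s≤s t≤x) (s≤s x≤t+2) =
  Sum.map (cong suc) (Sum.map (cong suc) (cong suc)) (t≤x≤t+2⇒x≡t∨t+1∨t+2 t t≤x x≤t+2)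

Admissible : ∀ t k → Subset (t + 2) → Subset m → Set
Admissible t k u v = t ≤ ∣ u ∣ × ∣ u ∣ + ∣ v ∣ < k

-- For m ≥ 3k these are exactly the members of I(A_t), grouped by the size of their trace on [t + 2].
admissibleSets : (t k m : ℕ) → List (Subset (t + 2 + m))
admissibleSets t k m = (stratum p m k t ++ₗ stratum p m k (t + 1)) ++ₗ stratum p m k (t + 2)
  where
  p : ℕ
  p = t + 2

admissibleSets-unique : ∀ t k m → Unique (admissibleSets t k m)
admissibleSets-unique t k m =
  ++⁺ (++⁺ (stratum-unique p m k t) (stratum-unique p m k (t + 1)) (stratum-disjoint p m k (t≢t+ 0)))
      (stratum-unique p m k (t + 2))
      disjoint
  where
  p : ℕ
  p = t + 2
  t≢t+ : ∀ c → t ≢ t + suc c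
  t≢t+ c e = m≢1+m+n t (trans e (+-suc t c))
  t+1≢t+2 : t + 1 ≢ t + 2
  t+1≢t+2 e = case +-cancelˡ-≡ t 1 2 e of λ ()
  disjoint : Disjoint (stratum p m k t ++ₗ stratum p m k (t + 1)) (stratum p m k (t + 2))
  disjoint (S∈ , S∈') with ∈-++⁻ (stratum p m k t) S∈
  ... | inj₁ S∈₀ = stratum-disjoint p m k (t≢t+ 1) (S∈₀ , S∈')
  ... | inj₂ S∈₁ = stratum-disjoint p m k t+1≢t+2 (S∈₁ , S∈')

∈-admissibleSets⁺ : ∀ t k m (u : Subset (t + 2)) (v : Subset m) →
  Admissible t k u v → u ++ v ∈ admissibleSets t k m
∈-admissibleSets⁺ t k m u v (t≤∣u∣ , ∣uv∣<k) with t≤x≤t+2⇒x≡t∨t+1∨t+2 t t≤∣u∣ (∣p∣≤n u)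
... | inj₁ ∣u∣≡t        = ∈-++⁺ˡ (∈-++⁺ˡ (∈-stratum⁺ u v ∣u∣≡t ∣uv∣<k))
... | inj₂ (inj₁ ∣u∣≡t+1) = ∈-++⁺ˡ (∈-++⁺ʳ (stratum _ m k t) (∈-stratum⁺ u v ∣u∣≡t+1 ∣uv∣<k))
... | inj₂ (inj₂ ∣u∣≡t+2) =
  ∈-++⁺ʳ (stratum _ m k t ++ₗ stratum _ m k (t + 1)) (∈-stratum⁺ u v ∣u∣≡t+2 ∣uv∣<k)

∈-admissibleSets⁻ : ∀ t k m (u : Subset (t + 2)) (v : Subset m) →
  u ++ v ∈ admissibleSets t k m → Admissible t k u v
∈-admissibleSets⁻ t k m u v uv∈ =
  Sum.[ Sum.[ weight≥t ≤-refl ∘ ∈-stratum⁻ u v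
            , weight≥t (m≤m+n t 1) ∘ ∈-stratum⁻ u v ] ∘ ∈-++⁻ (stratum p m k t)
      , weight≥t (m≤m+n t 2) ∘ ∈-stratum⁻ u v ]
      (∈-++⁻ (stratum p m k t ++ₗ stratum p m k (t + 1)) uv∈)
  where
  p : ℕ
  p = t + 2
  weight≥t : ∀ {a} → t ≤ a → ∣ u ∣ ≡ a × ∣ u ∣ + ∣ v ∣ < k → Admissible t k u v
  weight≥t t≤a (refl , ∣uv∣<k) = t≤a , ∣uv∣<k

length-admissibleSets : ∀ t k m → length (admissibleSets t k m) ≡ rhs (t + 2 + m) k t
length-admissibleSets t k m rewrite m+n∸m≡n (t + 2) m = begin
  length ((stratum p m k t ++ₗ stratum p m k (t + 1)) ++ₗ stratum p m k p)
    ≡⟨ length-++ (stratum p m k t ++ₗ stratum p m k (t + 1)) ⟩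
  length (stratum p m k t ++ₗ stratum p m k (t + 1)) + length (stratum p m k p)
    ≡⟨ cong (_+ length (stratum p m k p)) (length-++ (stratum p m k t)) ⟩
  length (stratum p m k t) + length (stratum p m k (t + 1)) + length (stratum p m k p)
    ≡⟨ cong₂ _+_ (cong₂ _+_ (length-stratum p m k t) (length-stratum p m k (t + 1)))
                 (length-stratum p m k p) ⟩
  (p C t) * σ t + (p C (t + 1)) * σ (t + 1) + (p C p) * σ p
    ≡⟨ cong (λ c → (p C t) * σ t + (p C (t + 1)) * σ (t + 1) + c * σ p) (nCn≡1 p) ⟩
  (p C t) * σ t + (p C (t + 1)) * σ (t + 1) + 1 * σ p
    ≡⟨ cong ((p C t) * σ t + (p C (t + 1)) * σ (t + 1) +_) (*-identityˡ (σ p)) ⟩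
  (p C t) * σ t + (p C (t + 1)) * σ (t + 1) + σ p
    ∎
  where
  open ≡-Reasoning
  p : ℕ
  p = t + 2
  σ : ℕ → ℕ
  σ a = sumBelow (k ∸ a) (m C_)

InI-intro : ∀ {n k t} (F G : Subset n) → InA n k t F → InA n k t G → ∣ F ∩ G ∣ < k → InI n k t (F ∩ G)
InI-intro F G F∈ G∈ ∣F∩G∣<k = F , G , F∈ , G∈ , F≢G , refl
  where
  F≢G : F ≢ G
  F≢G refl = <-irrefl (trans (cong ∣_∣ (∩-idem F)) (proj₁ F∈)) ∣F∩G∣<k

InA-++⁺ : ∀ t k (f : Subset (t + 2)) (f' : Subset m) →
  ∣ f ∣ + ∣ f' ∣ ≡ k → t + 1 ≤ ∣ f ∣ → InA (t + 2 + m) k t (f ++ f')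
InA-++⁺ t k f f' ∣f∣+∣f'∣≡k t+1≤∣f∣ =
  trans (∣p++q∣≡∣p∣+∣q∣ f f') ∣f∣+∣f'∣≡k , subst (t + 1 ≤_) (sym (∣p++q∩initSeg∣≡∣p∣ f f')) t+1≤∣f∣

InA-++⁻ : ∀ t k (f : Subset (t + 2)) (f' : Subset m) → InA (t + 2 + m) k t (f ++ f') → t + 1 ≤ ∣ f ∣
InA-++⁻ t k f f' (_ , t+1≤∣F∩P∣) = subst (t + 1 ≤_) (∣p++q∩initSeg∣≡∣p∣ f f') t+1≤∣F∩P∣

t≤∣p∩q∣ : ∀ t (p q : Subset (t + 2)) → t + 1 ≤ ∣ p ∣ → t + 1 ≤ ∣ q ∣ → t ≤ ∣ p ∩ q ∣
t≤∣p∩q∣ t p q t+1≤∣p∣ t+1≤∣q∣ = +-cancelˡ-≤ (t + 2) t ∣ p ∩ q ∣ (begin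
  t + 2 + t            ≡⟨ double t ⟩
  (t + 1) + (t + 1)    ≤⟨ +-mono-≤ t+1≤∣p∣ t+1≤∣q∣ ⟩
  ∣ p ∣ + ∣ q ∣        ≤⟨ ∣p∣+∣q∣≤n+∣p∩q∣ p q ⟩
  t + 2 + ∣ p ∩ q ∣    ∎)
  where
  open ≤-Reasoning
  double : ∀ t → t + 2 + t ≡ (t + 1) + (t + 1)
  double = solve-∀

InI⇒Admissible : ∀ t k m (u : Subset (t + 2)) (v : Subset m) →
  InI (t + 2 + m) k t (u ++ v) → Admissible t k u v
InI⇒Admissible t k m u v (F , G , F∈@(∣F∣≡k , _) , G∈@(∣G∣≡k , _) , F≢G , F∩G≡uv)
  with f , f' , refl ← splitAt (t + 2) F
     | g , g' , refl ← splitAt (t + 2) G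
  with refl , refl ← ++-injective (f ∩ g) u (trans (sym (zipWith-++ _∧_ f f' g g')) F∩G≡uv)
  = t≤∣p∩q∣ t f g (InA-++⁻ t k f f' F∈) (InA-++⁻ t k g g' G∈)
  , subst (_< k) (trans (cong ∣_∣ F∩G≡uv) (∣p++q∣≡∣p∣+∣q∣ (f ∩ g) (f' ∩ g')))
          (∣p∩q∣<k (f ++ f') (g ++ g') ∣F∣≡k ∣G∣≡k F≢G)

paddingInside : ∀ t {x y k} → t ≤ x → x ≤ t + 2 → x + y < k →
  Σ ℕ λ d → d + d + x ≤ t + 2 × t + 1 ≤ x + d × x + d + y ≤ k
paddingInside t {x} {y} {k} t≤x x≤t+2 x+y<k with m≤n⇒m<n∨m≡n t≤x
... | inj₂ refl = 1 , ≤-reflexive (+-comm 2 t) , ≤-refl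
                  , subst (_≤ k) (sym (trans (+-assoc t 1 y) (+-suc t y))) x+y<k
... | inj₁ t<x  = 0 , x≤t+2 , subst₂ _≤_ (+-comm 1 t) (sym (+-identityʳ x)) t<x
                  , subst (λ z → z + y ≤ k) (sym (+-identityʳ x)) (<⇒≤ x+y<k)

InI-byPadding : ∀ t k m (u : Subset (t + 2)) (v : Subset m) (d c : ℕ) →
  d + d + ∣ u ∣ ≤ t + 2 → c + c + ∣ v ∣ ≤ m → t + 1 ≤ ∣ u ∣ + d → ∣ u ∣ + d + (∣ v ∣ + c) ≡ k →
  ∣ u ∣ + ∣ v ∣ < k → InI (t + 2 + m) k t (u ++ v)
InI-byPadding t k m u v d c d+d+∣u∣≤p c+c+∣v∣≤m t+1≤∣u∣+d total ∣uv∣<k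
  with f , g , f∩g≡u , ∣f∣ , ∣g∣ ← extendApart u d d d+d+∣u∣≤p
     | f' , g' , f'∩g'≡v , ∣f'∣ , ∣g'∣ ← extendApart v c c c+c+∣v∣≤m
  = subst (InI _ k t) F∩G≡uv
      (InI-intro (f ++ f') (g ++ g')
        (InA-++⁺ t k f f' (trans (cong₂ _+_ ∣f∣ ∣f'∣) total) (subst (t + 1 ≤_) (sym ∣f∣) t+1≤∣u∣+d))
        (InA-++⁺ t k g g' (trans (cong₂ _+_ ∣g∣ ∣g'∣) total) (subst (t + 1 ≤_) (sym ∣g∣) t+1≤∣u∣+d))
        (subst (_< k) (sym (trans (cong ∣_∣ F∩G≡uv) (∣p++q∣≡∣p∣+∣q∣ u v))) ∣uv∣<k))
  where
  F∩G≡uv : (f ++ f') ∩ (g ++ g') ≡ u ++ v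
  F∩G≡uv = trans (zipWith-++ _∧_ f f' g g') (cong₂ _++_ f∩g≡u f'∩g'≡v)

Admissible⇒InI : ∀ t k m → k + k + k ≤ m → (u : Subset (t + 2)) (v : Subset m) →
  Admissible t k u v → InI (t + 2 + m) k t (u ++ v)
Admissible⇒InI t k m 3k≤m u v (t≤∣u∣ , ∣uv∣<k)
  with d , d+d+∣u∣≤p , t+1≤∣u∣+d , ∣u∣+d+∣v∣≤k ← paddingInside t t≤∣u∣ (∣p∣≤n u) ∣uv∣<k
  = InI-byPadding t k m u v d c d+d+∣u∣≤p c+c+∣v∣≤m t+1≤∣u∣+d total ∣uv∣<k
  where
  s c : ℕ
  s = ∣ u ∣ + d + ∣ v ∣
  c = k ∸ s
  c+c+∣v∣≤m : c + c + ∣ v ∣ ≤ m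
  c+c+∣v∣≤m = ≤-trans (+-mono-≤ (+-mono-≤ (m∸n≤m k s) (m∸n≤m k s)) (m+n≤o⇒n≤o ∣ u ∣ (<⇒≤ ∣uv∣<k))) 3k≤m
  total : ∣ u ∣ + d + (∣ v ∣ + c) ≡ k
  total = trans (sym (+-assoc (∣ u ∣ + d) ∣ v ∣ c)) (m+[n∸m]≡n ∣u∣+d+∣v∣≤k)

ListingOfI : (n k t : ℕ) → Set
ListingOfI n k t =
  Σ (List (Subset n)) λ L → Unique L × ((S : Subset n) → (S ∈ L) ⇔ InI n k t S) × (length L ≡ rhs n k t)

admissibleSets-listI : ∀ t k m → k + k + k ≤ m → ListingOfI (t + 2 + m) k t
admissibleSets-listI t k m 3k≤m =
  admissibleSets t k m , admissibleSets-unique t k m , ∈-admissibleSets⇔InI , length-admissibleSets t k m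
  where
  ∈-admissibleSets⇔InI : (S : Subset (t + 2 + m)) → S ∈ admissibleSets t k m ⇔ InI (t + 2 + m) k t S
  ∈-admissibleSets⇔InI S with u , v , refl ← splitAt (t + 2) S =
    mk⇔ (Admissible⇒InI t k m 3k≤m u v ∘ ∈-admissibleSets⁻ t k m u v)
        (∈-admissibleSets⁺ t k m u v ∘ InI⇒Admissible t k m u v)

proposition7 : (t k : ℕ) → 1 ≤ t → t + 1 ≤ k →
    Σ ℕ λ N → (n : ℕ) → N ≤ n →
    Σ (List (Subset n)) λ L →
    Unique L × ((S : Subset n) → (S ∈ L) ⇔ InI n k t S) × (length L ≡ rhs n k t)
proposition7 t k _ _ = t + 2 + (k + k + k) , λ n N≤n →
  subst (λ n → ListingOfI n k t) (m+[n∸m]≡n (m+n≤o⇒m≤o (t + 2) N≤n))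
        (admissibleSets-listI t k (n ∸ (t + 2)) (begin
          k + k + k                          ≡⟨ m+n∸m≡n (t + 2) (k + k + k) ⟨
          t + 2 + (k + k + k) ∸ (t + 2)      ≤⟨ ∸-monoˡ-≤ (t + 2) N≤n ⟩
          n ∸ (t + 2)                        ∎))
  where open ≤-Reasoning
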